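{- Let $r,j,k$ be natural numbers. Then $$\sum_{t=1}^jA(j,r,t)=\frac{(-1)^{j-1}}{(j-1)!}\prod_{i=1}^{j-1}(r+i-2)=\frac{(-1)^{j-1}}{(j-1)!}(r-1)r(r+1)\cdots (r+j-3),$$ $$\sum_{t=1}^kC(k,r,t)=\frac{(-1)^{k-1}}{(k-1)!}\prod_{i=2}^{k}(r-i)=\frac{(-1)^{k-1}}{(k-1)!}(r-2)(r-3)\cdots (r-k),$$ where empty products equal $1$.
   Context: $s(j,l)$ denotes the signed Stirling numbers of the first kind, $x(x-1)\cdots(x-j+1)=\sum_{l=0}^j s(j,l)x^l$. For natural numbers $j,r$ and integers $t\ge0$, $A(j,r,t)=\sum_{l=t}^j \frac{s(j,l)}{j!}\binom{l}{t}(1-r)^{l-t}$. For natural numbers $k,r$ and $1\le t\le k$, $C(k,r,t)=\sum_{j=0}^{k-t}\binom{k-1}{j+t-1}A(j+t,r,t)$. -}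

module Defs where

open import Data.Nat as ℕ using (ℕ; zero; suc; _!; _∸_)
import Data.Nat.Combinatorics as Comb
open import Data.Nat.Properties using (_!≢0)
open import Data.Integer as ℤ using (ℤ; +_; -[1+_])
open import Data.Rational as ℚ using (ℚ; 0ℚ; 1ℚ; _/_; _+_; _*_; _-_)

-- Coefficients of the polynomial x(x-1)...(x-j+1):
-- fallCoeff j l = coefficient of x^l.  Built by multiplying the polynomial
-- for j by (x - j) to obtain the polynomial for j+1.
fallCoeff : ℕ → ℕ → ℤ
fallCoeff zero zero = + 1
fallCoeff zero (suc l) = + 0
fallCoeff (suc j) zero = ℤ.- ((+ j) ℤ.* fallCoeff j zero)
fallCoeff (suc j) (suc l) = fallCoeff j l ℤ.- ((+ j) ℤ.* fallCoeff j (suc l))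

s : ℕ → ℕ → ℤ
s = fallCoeff

ℤ→ℚ : ℤ → ℚ
ℤ→ℚ z = z / 1

ℕ→ℚ : ℕ → ℚ
ℕ→ℚ n = ℤ→ℚ (+ n)

invFact : ℕ → ℚ
invFact n = _/_ (+ 1) (n !) {{n !≢0}}

powℚ : ℚ → ℕ → ℚ
powℚ q zero = 1ℚ
powℚ q (suc n) = q * powℚ q n

negOnePow : ℕ → ℤ
negOnePow zero = + 1
negOnePow (suc n) = ℤ.- negOnePow n

sumFrom : ℕ → ℕ → (ℕ → ℚ) → ℚ
sumFrom a zero f = 0ℚ
sumFrom a (suc n) f = f a + sumFrom (suc a) n f

-- Σ_{i=a}^{b} f i   (empty, i.e. 0, when b < a)
Σ[_⋯_] : ℕ → ℕ → (ℕ → ℚ) → ℚ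
Σ[ a ⋯ b ] f = sumFrom a (suc b ∸ a) f

prodFrom : ℕ → ℕ → (ℕ → ℤ) → ℤ
prodFrom a zero f = + 1
prodFrom a (suc n) f = f a ℤ.* prodFrom (suc a) n f

-- Π_{i=a}^{b} f i   (empty, i.e. 1, when b < a)
Π[_⋯_] : ℕ → ℕ → (ℕ → ℤ) → ℤ
Π[ a ⋯ b ] f = prodFrom a (suc b ∸ a) f

A : ℕ → ℕ → ℕ → ℚ
A j r t = Σ[ t ⋯ j ] (λ l →
  ℤ→ℚ (s j l) * invFact j * ℕ→ℚ (l Comb.C t) * powℚ (1ℚ - ℕ→ℚ r) (l ∸ t))

C : ℕ → ℕ → ℕ → ℚ
C k r t = Σ[ 0 ⋯ k ∸ t ] (λ j → ℕ→ℚ ((k ∸ 1) Comb.C (j ℕ.+ t ∸ 1)) * A (j ℕ.+ t) r t)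

{-# OPTIONS --safe #-}
module Submission where

-- Put x = 1 - r. The numbers s(j,l)/j! are the coefficients of the polynomial
-- binom(y,j) = y(y-1)...(y-j+1)/j!, so A(j,r,t) is its t-th Taylor coefficient at y = x,
-- and by the binomial theorem the sum over 0 ≤ t ≤ j evaluates it at x + 1. Hence
-- Σ_{t≥1} A(j,r,t) = binom(x+1,j) - binom(x,j) = binom(x,j-1) by Pascal's rule.
-- Writing C(k,r,t) as a sum over m = j + t and exchanging the two sums turns Σ_t C(k,r,t)
-- into Σ_m binom(k-1,m) binom(x,m) = binom(x+k-1,k-1) (Vandermonde's convolution).
-- With x = 1 - r both binomials expand to the signed products of the statement.

open import Defs
open import Data.Nat using (ℕ; _≤_; _∸_)

-- ℚ's operators are opened only inside this module: the statement of theorem2p8 below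
-- uses the names _+_, _-_ and _*_ for ℤ.
module _ where
  open import Data.Nat as ℕ using (zero; suc; _<_; s<s; _!)
  import Data.Nat.Properties as ℕ
  import Data.Nat.Combinatorics as Comb
  open import Data.Fin using (Fin; toℕ)
  import Data.Integer as ℤ
  import Data.Integer.Properties as ℤ
  import Data.Integer.Solver
  open import Data.Rational using (ℚ; 0ℚ; 1ℚ; _+_; _*_; _-_; -_; _/_; toℚᵘ; +-0-rawMonoid)
  open import Data.Rational.Properties
  import Data.Rational.Solver
  import Data.Rational.Unnormalised as ℚᵘ
  import Data.Rational.Unnormalised.Properties as ℚᵘ
  open import Algebra.Bundles using (CommutativeRing)
  import Algebra.Definitions.RawMonoid +-0-rawMonoid as Additive
  import Algebra.Properties.Semiring.Exp (CommutativeRing.semiring +-*-commutativeRing) as Exp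
  import Algebra.Properties.CommutativeSemiring.Binomial
    (CommutativeRing.commutativeSemiring +-*-commutativeRing) as Binomial
  open import Function using (_∘_)
  open import Relation.Binary.PropositionalEquality
    using (_≡_; refl; sym; trans; cong; cong₂; module ≡-Reasoning)

  module ℚ-Solver = Data.Rational.Solver.+-*-Solver
  module ℤ-Solver = Data.Integer.Solver.+-*-Solver

  ∑ : ℕ → (ℕ → ℚ) → ℚ
  ∑ = sumFrom 0

  sumFrom-suc : ∀ a n f → sumFrom (suc a) n f ≡ sumFrom a n (f ∘ suc)
  sumFrom-suc a zero    f = refl
  sumFrom-suc a (suc n) f = cong (f (suc a) +_) (sumFrom-suc (suc a) n f)

  sumFrom-shift : ∀ a n f → sumFrom a n f ≡ ∑ n (λ i → f (a ℕ.+ i))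
  sumFrom-shift zero    n f = refl
  sumFrom-shift (suc a) n f = trans (sumFrom-suc a n f) (sumFrom-shift a n (f ∘ suc))

  ∑-suc : ∀ n f → ∑ (suc n) f ≡ f 0 + ∑ n (f ∘ suc)
  ∑-suc n f = cong (f 0 +_) (sumFrom-suc 0 n f)

  ∑-cong : ∀ n {f g} → (∀ i → i < n → f i ≡ g i) → ∑ n f ≡ ∑ n g
  ∑-cong zero    f≡g = refl
  ∑-cong (suc n) {f} {g} f≡g = begin
    ∑ (suc n) f            ≡⟨ ∑-suc n f ⟩
    f 0 + ∑ n (f ∘ suc)    ≡⟨ cong₂ _+_ (f≡g 0 ℕ.z<s) (∑-cong n (λ i i<n → f≡g (suc i) (s<s i<n))) ⟩
    g 0 + ∑ n (g ∘ suc)    ≡⟨ ∑-suc n g ⟨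
    ∑ (suc n) g            ∎
    where open ≡-Reasoning

  sumFrom-vanishing : ∀ a n {f} → (∀ i → a ≤ i → f i ≡ 0ℚ) → sumFrom a n f ≡ 0ℚ
  sumFrom-vanishing a zero    f≡0 = refl
  sumFrom-vanishing a (suc n) f≡0 =
    cong₂ _+_ (f≡0 a ℕ.≤-refl) (sumFrom-vanishing (suc a) n (λ i a<i → f≡0 i (ℕ.<⇒≤ a<i)))

  sumFrom-+ : ∀ a n f g → sumFrom a n (λ i → f i + g i) ≡ sumFrom a n f + sumFrom a n g
  sumFrom-+ a zero    f g = refl
  sumFrom-+ a (suc n) f g = begin
    (f a + g a) + sumFrom (suc a) n (λ i → f i + g i)
      ≡⟨ cong ((f a + g a) +_) (sumFrom-+ (suc a) n f g) ⟩
    (f a + g a) + (F + G)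
      ≡⟨ solve 4 (λ u v U V → (u :+ v) :+ (U :+ V) := (u :+ U) :+ (v :+ V)) refl (f a) (g a) F G ⟩
    (f a + F) + (g a + G)
      ∎
    where
    open ≡-Reasoning
    open ℚ-Solver
    F = sumFrom (suc a) n f
    G = sumFrom (suc a) n g

  *-distribˡ-sumFrom : ∀ c a n f → c * sumFrom a n f ≡ sumFrom a n (λ i → c * f i)
  *-distribˡ-sumFrom c a zero    f = *-zeroʳ c
  *-distribˡ-sumFrom c a (suc n) f =
    trans (*-distribˡ-+ c (f a) _) (cong (c * f a +_) (*-distribˡ-sumFrom c (suc a) n f))

  sumFrom-comm : ∀ a n b m (f : ℕ → ℕ → ℚ) →
    sumFrom a n (λ i → sumFrom b m (f i)) ≡ sumFrom b m (λ k → sumFrom a n (λ i → f i k))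
  sumFrom-comm a zero    b m f = sym (sumFrom-vanishing b m (λ _ _ → refl))
  sumFrom-comm a (suc n) b m f =
    trans (cong (sumFrom b m (f a) +_) (sumFrom-comm (suc a) n b m f)) (sym (sumFrom-+ b m (f a) _))

  sumFrom-++ : ∀ a n d f → sumFrom a (n ℕ.+ d) f ≡ sumFrom a n f + sumFrom (a ℕ.+ n) d f
  sumFrom-++ a zero    d f = begin
    sumFrom a d f                  ≡⟨ cong (λ b → sumFrom b d f) (ℕ.+-identityʳ a) ⟨
    sumFrom (a ℕ.+ 0) d f          ≡⟨ +-identityˡ _ ⟨
    0ℚ + sumFrom (a ℕ.+ 0) d f     ∎
    where open ≡-Reasoning
  sumFrom-++ a (suc n) d f = begin
    f a + sumFrom (suc a) (n ℕ.+ d) f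
      ≡⟨ cong (f a +_) (sumFrom-++ (suc a) n d f) ⟩
    f a + (sumFrom (suc a) n f + sumFrom (suc a ℕ.+ n) d f)
      ≡⟨ +-assoc (f a) _ _ ⟨
    sumFrom a (suc n) f + sumFrom (suc a ℕ.+ n) d f
      ≡⟨ cong (λ b → sumFrom a (suc n) f + sumFrom b d f) (ℕ.+-suc a n) ⟨
    sumFrom a (suc n) f + sumFrom (a ℕ.+ suc n) d f
      ∎
    where open ≡-Reasoning

  ∑-extend : ∀ {n m} f → n ≤ m → (∀ i → n ≤ i → f i ≡ 0ℚ) → ∑ m f ≡ ∑ n f
  ∑-extend {n} {m} f n≤m f≡0 = begin
    ∑ m f                         ≡⟨ cong (λ k → ∑ k f) (ℕ.m+[n∸m]≡n n≤m) ⟨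
    ∑ (n ℕ.+ (m ∸ n)) f           ≡⟨ sumFrom-++ 0 n (m ∸ n) f ⟩
    ∑ n f + sumFrom n (m ∸ n) f   ≡⟨ cong (∑ n f +_) (sumFrom-vanishing n (m ∸ n) f≡0) ⟩
    ∑ n f + 0ℚ                    ≡⟨ +-identityʳ _ ⟩
    ∑ n f                         ∎
    where open ≡-Reasoning

  sumFrom-extend : ∀ a n f → (∀ i → i < a → f i ≡ 0ℚ) → sumFrom a n f ≡ ∑ (a ℕ.+ n) f
  sumFrom-extend a n f f≡0 = begin
    sumFrom a n f            ≡⟨ +-identityˡ _ ⟨
    0ℚ + sumFrom a n f       ≡⟨ cong (_+ sumFrom a n f) ∑a≡0 ⟨
    ∑ a f + sumFrom a n f    ≡⟨ sumFrom-++ 0 a n f ⟨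
    ∑ (a ℕ.+ n) f            ∎
    where
    open ≡-Reasoning
    ∑a≡0 : ∑ a f ≡ 0ℚ
    ∑a≡0 = trans (∑-cong a f≡0) (sumFrom-vanishing 0 a (λ _ _ → refl))

  toℚᵘ-ℤ→ℚ : ∀ z → toℚᵘ (ℤ→ℚ z) ℚᵘ.≃ ℚᵘ.mkℚᵘ z 0
  toℚᵘ-ℤ→ℚ z = toℚᵘ-fromℚᵘ (ℚᵘ.mkℚᵘ z 0)

  ℤ→ℚ-homo-+ : ∀ a b → ℤ→ℚ (a ℤ.+ b) ≡ ℤ→ℚ a + ℤ→ℚ b
  ℤ→ℚ-homo-+ a b = toℚᵘ-injective (begin
    toℚᵘ (ℤ→ℚ (a ℤ.+ b))
      ≈⟨ toℚᵘ-ℤ→ℚ (a ℤ.+ b) ⟩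
    ℚᵘ.mkℚᵘ (a ℤ.+ b) 0
      ≈⟨ ℚᵘ.*≡* (cong (ℤ._* ℤ.+ 1) (cong₂ ℤ._+_ (ℤ.*-identityʳ a) (ℤ.*-identityʳ b))) ⟨
    ℚᵘ.mkℚᵘ a 0 ℚᵘ.+ ℚᵘ.mkℚᵘ b 0
      ≈⟨ ℚᵘ.+-cong (toℚᵘ-ℤ→ℚ a) (toℚᵘ-ℤ→ℚ b) ⟨
    toℚᵘ (ℤ→ℚ a) ℚᵘ.+ toℚᵘ (ℤ→ℚ b)
      ≈⟨ toℚᵘ-homo-+ (ℤ→ℚ a) (ℤ→ℚ b) ⟨
    toℚᵘ (ℤ→ℚ a + ℤ→ℚ b)
      ∎)
    where open ℚᵘ.≃-Reasoning

  ℤ→ℚ-homo-* : ∀ a b → ℤ→ℚ (a ℤ.* b) ≡ ℤ→ℚ a * ℤ→ℚ b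
  ℤ→ℚ-homo-* a b = toℚᵘ-injective (begin
    toℚᵘ (ℤ→ℚ (a ℤ.* b))                  ≈⟨ toℚᵘ-ℤ→ℚ (a ℤ.* b) ⟩
    ℚᵘ.mkℚᵘ (a ℤ.* b) 0                    ≈⟨ ℚᵘ.*-cong (toℚᵘ-ℤ→ℚ a) (toℚᵘ-ℤ→ℚ b) ⟨
    toℚᵘ (ℤ→ℚ a) ℚᵘ.* toℚᵘ (ℤ→ℚ b)        ≈⟨ toℚᵘ-homo-* (ℤ→ℚ a) (ℤ→ℚ b) ⟨
    toℚᵘ (ℤ→ℚ a * ℤ→ℚ b)                  ∎)
    where open ℚᵘ.≃-Reasoning

  ℤ→ℚ-homo‿- : ∀ a → ℤ→ℚ (ℤ.- a) ≡ - ℤ→ℚ a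
  ℤ→ℚ-homo‿- a = toℚᵘ-injective (begin
    toℚᵘ (ℤ→ℚ (ℤ.- a))     ≈⟨ toℚᵘ-ℤ→ℚ (ℤ.- a) ⟩
    ℚᵘ.mkℚᵘ (ℤ.- a) 0       ≈⟨ ℚᵘ.-‿cong (toℚᵘ-ℤ→ℚ a) ⟨
    ℚᵘ.- toℚᵘ (ℤ→ℚ a)      ≈⟨ toℚᵘ-homo‿- (ℤ→ℚ a) ⟨
    toℚᵘ (- ℤ→ℚ a)         ∎)
    where open ℚᵘ.≃-Reasoning

  ℤ→ℚ-homo-minus : ∀ a b → ℤ→ℚ (a ℤ.- b) ≡ ℤ→ℚ a - ℤ→ℚ b
  ℤ→ℚ-homo-minus a b = trans (ℤ→ℚ-homo-+ a (ℤ.- b)) (cong (ℤ→ℚ a +_) (ℤ→ℚ-homo‿- b))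

  ℕ→ℚ-suc : ∀ n → ℕ→ℚ (suc n) ≡ 1ℚ + ℕ→ℚ n
  ℕ→ℚ-suc n = ℤ→ℚ-homo-+ (ℤ.+ 1) (ℤ.+ n)

  ℕ→ℚ-homo-+ : ∀ m n → ℕ→ℚ (m ℕ.+ n) ≡ ℕ→ℚ m + ℕ→ℚ n
  ℕ→ℚ-homo-+ m n = ℤ→ℚ-homo-+ (ℤ.+ m) (ℤ.+ n)

  ℕ→ℚ-homo-* : ∀ m n → ℕ→ℚ (m ℕ.* n) ≡ ℕ→ℚ m * ℕ→ℚ n
  ℕ→ℚ-homo-* m n = trans (cong ℤ→ℚ (ℤ.pos-* m n)) (ℤ→ℚ-homo-* (ℤ.+ m) (ℤ.+ n))

  ℕ→ℚ-pascal : ∀ n k → ℕ→ℚ (suc n Comb.C suc k) ≡ ℕ→ℚ (n Comb.C k) + ℕ→ℚ (n Comb.C suc k)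
  ℕ→ℚ-pascal n k =
    trans (cong ℕ→ℚ (sym (Comb.nCk+nC[k+1]≡[n+1]C[k+1] n k))) (ℕ→ℚ-homo-+ (n Comb.C k) (n Comb.C suc k))

  1/n*n≡1 : ∀ n .{{_ : ℕ.NonZero n}} → (ℤ.+ 1 / n) * ℕ→ℚ n ≡ 1ℚ
  1/n*n≡1 (suc n) = toℚᵘ-injective (begin
    toℚᵘ ((ℤ.+ 1 / suc n) * ℕ→ℚ (suc n))
      ≈⟨ toℚᵘ-homo-* (ℤ.+ 1 / suc n) (ℕ→ℚ (suc n)) ⟩
    toℚᵘ (ℤ.+ 1 / suc n) ℚᵘ.* toℚᵘ (ℕ→ℚ (suc n))
      ≈⟨ ℚᵘ.*-cong (toℚᵘ-fromℚᵘ (ℚᵘ.mkℚᵘ (ℤ.+ 1) n)) (toℚᵘ-ℤ→ℚ (ℤ.+ suc n)) ⟩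
    ℚᵘ.1/ d ℚᵘ.* d
      ≈⟨ ℚᵘ.*-inverseˡ d ⟩
    ℚᵘ.1ℚᵘ
      ∎)
    where
    open ℚᵘ.≃-Reasoning
    d = ℚᵘ.mkℚᵘ (ℤ.+ suc n) 0

  invFact-suc : ∀ n → invFact n ≡ ℕ→ℚ (suc n) * invFact (suc n)
  invFact-suc n = begin
    a                    ≡⟨ *-identityʳ a ⟨
    a * 1ℚ               ≡⟨ cong (a *_) b*M*F≡1 ⟨
    a * (b * (M * F))    ≡⟨ solve 4 (λ a b M F → a :* (b :* (M :* F)) := (M :* b) :* (a :* F)) refl a b M F ⟩
    (M * b) * (a * F)    ≡⟨ cong ((M * b) *_) (1/n*n≡1 (n !) {{n ℕ.!≢0}}) ⟩
    (M * b) * 1ℚ         ≡⟨ *-identityʳ (M * b) ⟩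
    M * b                ∎
    where
    open ≡-Reasoning
    open ℚ-Solver
    a = invFact n
    b = invFact (suc n)
    M = ℕ→ℚ (suc n)
    F = ℕ→ℚ (n !)
    b*M*F≡1 : b * (M * F) ≡ 1ℚ
    b*M*F≡1 = trans (cong (b *_) (sym (ℕ→ℚ-homo-* (suc n) (n !)))) (1/n*n≡1 (suc n !) {{suc n ℕ.!≢0}})

  falling : ℕ → ℚ → ℚ
  falling zero    y = 1ℚ
  falling (suc j) y = falling j y * (y - ℕ→ℚ j)

  falling-suc-shift : ∀ j y → falling (suc j) (1ℚ + y) ≡ (1ℚ + y) * falling j y
  falling-suc-shift zero    y =
    solve 1 (λ y → con 1ℚ :* ((con 1ℚ :+ y) :- con 0ℚ) := (con 1ℚ :+ y) :* con 1ℚ) refl y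
    where open ℚ-Solver
  falling-suc-shift (suc j) y = begin
    falling (suc j) (1ℚ + y) * ((1ℚ + y) - ℕ→ℚ (suc j))
      ≡⟨ cong₂ (λ u v → u * ((1ℚ + y) - v)) (falling-suc-shift j y) (ℕ→ℚ-suc j) ⟩
    (1ℚ + y) * F * ((1ℚ + y) - (1ℚ + J))
      ≡⟨ solve 3 (λ y F J → (con 1ℚ :+ y) :* F :* ((con 1ℚ :+ y) :- (con 1ℚ :+ J))
                           := (con 1ℚ :+ y) :* (F :* (y :- J))) refl y F J ⟩
    (1ℚ + y) * (F * (y - J))
      ∎
    where
    open ≡-Reasoning
    open ℚ-Solver
    F = falling j y
    J = ℕ→ℚ j

  infix 8 _choose_

  _choose_ : ℚ → ℕ → ℚ
  y choose d = falling d y * invFact d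

  choose-pascal : ∀ y e → (1ℚ + y) choose suc e ≡ y choose suc e + y choose e
  choose-pascal y e = begin
    falling (suc e) (1ℚ + y) * I
      ≡⟨ cong (_* I) (falling-suc-shift e y) ⟩
    (1ℚ + y) * F * I
      ≡⟨ solve 4 (λ y F E I → (con 1ℚ :+ y) :* F :* I := F :* (y :- E) :* I :+ F :* ((con 1ℚ :+ E) :* I))
                 refl y F E I ⟩
    F * (y - E) * I + F * ((1ℚ + E) * I)
      ≡⟨ cong (λ u → F * (y - E) * I + F * (u * I)) (ℕ→ℚ-suc e) ⟨
    F * (y - E) * I + F * (ℕ→ℚ (suc e) * I)
      ≡⟨ cong (λ u → F * (y - E) * I + F * u) (invFact-suc e) ⟨
    F * (y - E) * I + F * invFact e
      ∎
    where
    open ≡-Reasoning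
    open ℚ-Solver
    F = falling e y
    E = ℕ→ℚ e
    I = invFact (suc e)

  s-suc-zero : ∀ j → ℤ→ℚ (s (suc j) 0) ≡ - ℕ→ℚ j * ℤ→ℚ (s j 0)
  s-suc-zero j = begin
    ℤ→ℚ (ℤ.- (ℤ.+ j ℤ.* s j 0))        ≡⟨ ℤ→ℚ-homo‿- (ℤ.+ j ℤ.* s j 0) ⟩
    - ℤ→ℚ (ℤ.+ j ℤ.* s j 0)            ≡⟨ cong -_ (ℤ→ℚ-homo-* (ℤ.+ j) (s j 0)) ⟩
    - (ℕ→ℚ j * ℤ→ℚ (s j 0))            ≡⟨ neg-distribˡ-* (ℕ→ℚ j) (ℤ→ℚ (s j 0)) ⟩
    - ℕ→ℚ j * ℤ→ℚ (s j 0)              ∎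
    where open ≡-Reasoning

  s-suc-suc : ∀ j l → ℤ→ℚ (s (suc j) (suc l)) ≡ ℤ→ℚ (s j l) - ℕ→ℚ j * ℤ→ℚ (s j (suc l))
  s-suc-suc j l = begin
    ℤ→ℚ (s j l ℤ.- ℤ.+ j ℤ.* s j (suc l))
      ≡⟨ ℤ→ℚ-homo-minus (s j l) (ℤ.+ j ℤ.* s j (suc l)) ⟩
    ℤ→ℚ (s j l) - ℤ→ℚ (ℤ.+ j ℤ.* s j (suc l))
      ≡⟨ cong (λ u → ℤ→ℚ (s j l) - u) (ℤ→ℚ-homo-* (ℤ.+ j) (s j (suc l))) ⟩
    ℤ→ℚ (s j l) - ℕ→ℚ j * ℤ→ℚ (s j (suc l))
      ∎
    where open ≡-Reasoning

  ∑-stirling : ∀ j N y → j < N → ∑ N (λ l → ℤ→ℚ (s j l) * powℚ y l) ≡ falling j y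
  ∑-stirling zero (suc N) y _ = cong (1ℚ * 1ℚ +_) (sumFrom-vanishing 1 N higher-terms)
    where
    higher-terms : ∀ l → 1 ≤ l → ℤ→ℚ (s 0 l) * powℚ y l ≡ 0ℚ
    higher-terms (suc l) _ = *-zeroˡ (powℚ y (suc l))
  ∑-stirling (suc j) (suc N) y (s<s j<N) = begin
    ∑ (suc N) (λ l → ℤ→ℚ (s (suc j) l) * powℚ y l)
      ≡⟨ ∑-suc N (λ l → ℤ→ℚ (s (suc j) l) * powℚ y l) ⟩
    ℤ→ℚ (s (suc j) 0) * 1ℚ + ∑ N (λ l → ℤ→ℚ (s (suc j) (suc l)) * powℚ y (suc l))
      ≡⟨ cong₂ _+_ constant-term (∑-cong N (λ l _ → term l)) ⟩
    - J * g 0 + ∑ N (λ l → y * g l + - J * g (suc l))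
      ≡⟨ cong (- J * g 0 +_) (sumFrom-+ 0 N (λ l → y * g l) (λ l → - J * g (suc l))) ⟩
    - J * g 0 + (∑ N (λ l → y * g l) + ∑ N (λ l → - J * g (suc l)))
      ≡⟨ cong (- J * g 0 +_) (cong₂ _+_ (*-distribˡ-sumFrom y 0 N g) (*-distribˡ-sumFrom (- J) 0 N (g ∘ suc))) ⟨
    - J * g 0 + (y * ∑ N g + - J * ∑ N (g ∘ suc))
      ≡⟨ solve 5 (λ J g₀ y G G′ → :- J :* g₀ :+ (y :* G :+ :- J :* G′) := y :* G :+ :- J :* (g₀ :+ G′))
                 refl J (g 0) y (∑ N g) (∑ N (g ∘ suc)) ⟩
    y * ∑ N g + - J * (g 0 + ∑ N (g ∘ suc))
      ≡⟨ cong (λ u → y * ∑ N g + - J * u) (∑-suc N g) ⟨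
    y * ∑ N g + - J * ∑ (suc N) g
      ≡⟨ cong₂ (λ u v → y * u + - J * v) (∑-stirling j N y j<N)
                                         (∑-stirling j (suc N) y (ℕ.m<n⇒m<1+n j<N)) ⟩
    y * falling j y + - J * falling j y
      ≡⟨ solve 3 (λ y F J → y :* F :+ :- J :* F := F :* (y :- J)) refl y (falling j y) J ⟩
    falling j y * (y - J)
      ∎
    where
    open ≡-Reasoning
    open ℚ-Solver
    J = ℕ→ℚ j
    g : ℕ → ℚ
    g l = ℤ→ℚ (s j l) * powℚ y l
    constant-term : ℤ→ℚ (s (suc j) 0) * 1ℚ ≡ - J * g 0
    constant-term = trans (cong (_* 1ℚ) (s-suc-zero j)) (*-assoc (- J) (ℤ→ℚ (s j 0)) 1ℚ)
    term : ∀ l → ℤ→ℚ (s (suc j) (suc l)) * powℚ y (suc l) ≡ y * g l + - J * g (suc l)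
    term l = begin
      ℤ→ℚ (s (suc j) (suc l)) * (y * p)
        ≡⟨ cong (_* (y * p)) (s-suc-suc j l) ⟩
      (a - J * b) * (y * p)
        ≡⟨ solve 5 (λ a J b y p → (a :- J :* b) :* (y :* p) := y :* (a :* p) :+ :- J :* (b :* (y :* p)))
                   refl a J b y p ⟩
      y * g l + - J * g (suc l)
        ∎
      where
      a = ℤ→ℚ (s j l)
      b = ℤ→ℚ (s j (suc l))
      p = powℚ y l

  ∑≡sum : ∀ n f → ∑ n f ≡ Additive.sum (λ (i : Fin n) → f (toℕ i))
  ∑≡sum zero    f = refl
  ∑≡sum (suc n) f = trans (∑-suc n f) (cong (f 0 +_) (∑≡sum n (f ∘ suc)))

  ×≡ℕ→ℚ* : ∀ n q → n Additive.× q ≡ ℕ→ℚ n * q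
  ×≡ℕ→ℚ* zero    q = sym (*-zeroˡ q)
  ×≡ℕ→ℚ* (suc n) q = begin
    q + n Additive.× q     ≡⟨ cong (q +_) (×≡ℕ→ℚ* n q) ⟩
    q + ℕ→ℚ n * q          ≡⟨ cong (_+ ℕ→ℚ n * q) (*-identityˡ q) ⟨
    1ℚ * q + ℕ→ℚ n * q     ≡⟨ *-distribʳ-+ q 1ℚ (ℕ→ℚ n) ⟨
    (1ℚ + ℕ→ℚ n) * q       ≡⟨ cong (_* q) (ℕ→ℚ-suc n) ⟨
    ℕ→ℚ (suc n) * q        ∎
    where open ≡-Reasoning

  ^≡powℚ : ∀ q n → q Exp.^ n ≡ powℚ q n
  ^≡powℚ q zero    = refl
  ^≡powℚ q (suc n) = cong (q *_) (^≡powℚ q n)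

  1^n≡1 : ∀ n → 1ℚ Exp.^ n ≡ 1ℚ
  1^n≡1 zero    = refl
  1^n≡1 (suc n) = trans (*-identityˡ (1ℚ Exp.^ n)) (1^n≡1 n)

  ∑-binomial : ∀ l N y → l < N → ∑ N (λ t → ℕ→ℚ (l Comb.C t) * powℚ y (l ∸ t)) ≡ powℚ (1ℚ + y) l
  ∑-binomial l N y l<N = begin
    ∑ N term                            ≡⟨ ∑-extend term l<N beyond-l ⟩
    ∑ (suc l) term                      ≡⟨ ∑-cong (suc l) (λ t _ → library-term t) ⟨
    ∑ (suc l) library                   ≡⟨ ∑≡sum (suc l) library ⟩
    Binomial.binomialExpansion 1ℚ y l   ≡⟨ Binomial.theorem l 1ℚ y ⟨
    (1ℚ + y) Exp.^ l                    ≡⟨ ^≡powℚ (1ℚ + y) l ⟩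
    powℚ (1ℚ + y) l                     ∎
    where
    open ≡-Reasoning
    term : ℕ → ℚ
    term t = ℕ→ℚ (l Comb.C t) * powℚ y (l ∸ t)
    library : ℕ → ℚ
    library t = (l Comb.C t) Additive.× (1ℚ Exp.^ t * y Exp.^ (l ∸ t))
    beyond-l : ∀ t → l < t → term t ≡ 0ℚ
    beyond-l t l<t =
      trans (cong (λ c → ℕ→ℚ c * powℚ y (l ∸ t)) (Comb.k>n⇒nCk≡0 l<t)) (*-zeroˡ (powℚ y (l ∸ t)))
    library-term : ∀ t → library t ≡ term t
    library-term t = begin
      (l Comb.C t) Additive.× (1ℚ Exp.^ t * y Exp.^ (l ∸ t))
        ≡⟨ ×≡ℕ→ℚ* (l Comb.C t) _ ⟩
      ℕ→ℚ (l Comb.C t) * (1ℚ Exp.^ t * y Exp.^ (l ∸ t))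
        ≡⟨ cong (λ u → ℕ→ℚ (l Comb.C t) * (u * y Exp.^ (l ∸ t))) (1^n≡1 t) ⟩
      ℕ→ℚ (l Comb.C t) * (1ℚ * y Exp.^ (l ∸ t))
        ≡⟨ cong (ℕ→ℚ (l Comb.C t) *_) (trans (*-identityˡ _) (^≡powℚ y (l ∸ t))) ⟩
      ℕ→ℚ (l Comb.C t) * powℚ y (l ∸ t)
        ∎

  ∑-vandermonde : ∀ K N d y → K < N →
    ∑ N (λ n → ℕ→ℚ (K Comb.C n) * y choose (d ℕ.+ n)) ≡ (y + ℕ→ℚ K) choose (d ℕ.+ K)
  ∑-vandermonde zero (suc N) d y _ = begin
    1ℚ * y choose (d ℕ.+ 0) + sumFrom 1 N (λ n → ℕ→ℚ (0 Comb.C n) * y choose (d ℕ.+ n))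
      ≡⟨ cong (1ℚ * y choose (d ℕ.+ 0) +_) (sumFrom-vanishing 1 N higher-terms) ⟩
    1ℚ * y choose (d ℕ.+ 0) + 0ℚ
      ≡⟨ solve 1 (λ b → con 1ℚ :* b :+ con 0ℚ := b) refl (y choose (d ℕ.+ 0)) ⟩
    y choose (d ℕ.+ 0)
      ≡⟨ cong (_choose (d ℕ.+ 0)) (+-identityʳ y) ⟨
    (y + 0ℚ) choose (d ℕ.+ 0)
      ∎
    where
    open ≡-Reasoning
    open ℚ-Solver
    higher-terms : ∀ n → 1 ≤ n → ℕ→ℚ (0 Comb.C n) * y choose (d ℕ.+ n) ≡ 0ℚ
    higher-terms (suc n) _ = *-zeroˡ (y choose (d ℕ.+ suc n))
  ∑-vandermonde (suc K) (suc N) d y (s<s K<N) = begin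
    ∑ (suc N) (λ n → ℕ→ℚ (suc K Comb.C n) * y choose (d ℕ.+ n))
      ≡⟨ ∑-suc N (λ n → ℕ→ℚ (suc K Comb.C n) * y choose (d ℕ.+ n)) ⟩
    h₀ + ∑ N (λ n → ℕ→ℚ (suc K Comb.C suc n) * y choose (d ℕ.+ suc n))
      ≡⟨ cong (h₀ +_) (trans (∑-cong N (λ n _ → pascal n)) (sumFrom-+ 0 N _ _)) ⟩
    h₀ + (∑ N (λ n → ℕ→ℚ (K Comb.C n) * y choose (d ℕ.+ suc n)) + R)
      ≡⟨ cong (λ u → h₀ + (u + R)) (trans (∑-cong N (λ n _ → shift n)) (∑-vandermonde K N (suc d) y K<N)) ⟩
    h₀ + (y′ choose (suc d ℕ.+ K) + R)
      ≡⟨ solve 3 (λ u v w → u :+ (v :+ w) := v :+ (u :+ w)) refl h₀ (y′ choose (suc d ℕ.+ K)) R ⟩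
    y′ choose suc (d ℕ.+ K) + (h₀ + R)
      ≡⟨ cong (y′ choose suc (d ℕ.+ K) +_) (∑-suc N (λ n → ℕ→ℚ (K Comb.C n) * y choose (d ℕ.+ n))) ⟨
    y′ choose suc (d ℕ.+ K) + ∑ (suc N) (λ n → ℕ→ℚ (K Comb.C n) * y choose (d ℕ.+ n))
      ≡⟨ cong (y′ choose suc (d ℕ.+ K) +_) (∑-vandermonde K (suc N) d y (ℕ.m<n⇒m<1+n K<N)) ⟩
    y′ choose suc (d ℕ.+ K) + y′ choose (d ℕ.+ K)
      ≡⟨ choose-pascal y′ (d ℕ.+ K) ⟨
    (1ℚ + y′) choose suc (d ℕ.+ K)
      ≡⟨ cong₂ _choose_ 1+y′≡y+[1+K] (sym (ℕ.+-suc d K)) ⟩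
    (y + ℕ→ℚ (suc K)) choose (d ℕ.+ suc K)
      ∎
    where
    open ≡-Reasoning
    open ℚ-Solver
    y′ = y + ℕ→ℚ K
    h₀ = 1ℚ * y choose (d ℕ.+ 0)
    R = ∑ N (λ n → ℕ→ℚ (K Comb.C suc n) * y choose (d ℕ.+ suc n))
    pascal : ∀ n → ℕ→ℚ (suc K Comb.C suc n) * y choose (d ℕ.+ suc n)
                   ≡ ℕ→ℚ (K Comb.C n) * y choose (d ℕ.+ suc n) + ℕ→ℚ (K Comb.C suc n) * y choose (d ℕ.+ suc n)
    pascal n = trans (cong (_* y choose (d ℕ.+ suc n)) (ℕ→ℚ-pascal K n))
                     (*-distribʳ-+ (y choose (d ℕ.+ suc n)) (ℕ→ℚ (K Comb.C n)) (ℕ→ℚ (K Comb.C suc n)))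
    shift : ∀ n → ℕ→ℚ (K Comb.C n) * y choose (d ℕ.+ suc n) ≡ ℕ→ℚ (K Comb.C n) * y choose (suc d ℕ.+ n)
    shift n = cong (λ m → ℕ→ℚ (K Comb.C n) * y choose m) (ℕ.+-suc d n)
    1+y′≡y+[1+K] : 1ℚ + y′ ≡ y + ℕ→ℚ (suc K)
    1+y′≡y+[1+K] = trans (solve 2 (λ y K → con 1ℚ :+ (y :+ K) := y :+ (con 1ℚ :+ K)) refl y (ℕ→ℚ K))
                         (cong (y +_) (sym (ℕ→ℚ-suc K)))

  A-summand : ℕ → ℕ → ℕ → ℕ → ℚ
  A-summand j r t l = ℤ→ℚ (s j l) * invFact j * ℕ→ℚ (l Comb.C t) * powℚ (1ℚ - ℕ→ℚ r) (l ∸ t)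

  A-vanishes : ∀ {j t} r → j < t → A j r t ≡ 0ℚ
  A-vanishes {j} {t} r j<t = cong (λ n → sumFrom t n (A-summand j r t)) (ℕ.m≤n⇒m∸n≡0 j<t)

  A-as-∑ : ∀ j r t → t ≤ suc j → A j r t ≡ ∑ (suc j) (A-summand j r t)
  A-as-∑ j r t t≤1+j = trans (sumFrom-extend t (suc j ∸ t) (A-summand j r t) below-t)
                             (cong (λ n → ∑ n (A-summand j r t)) (ℕ.m+[n∸m]≡n t≤1+j))
    where
    below-t : ∀ l → l < t → A-summand j r t l ≡ 0ℚ
    below-t l l<t rewrite Comb.k>n⇒nCk≡0 l<t =
      trans (cong (_* powℚ (1ℚ - ℕ→ℚ r) (l ∸ t)) (*-zeroʳ (ℤ→ℚ (s j l) * invFact j)))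
            (*-zeroˡ (powℚ (1ℚ - ℕ→ℚ r) (l ∸ t)))

  A-zero : ∀ j r → A j r 0 ≡ (1ℚ - ℕ→ℚ r) choose j
  A-zero j r = begin
    ∑ (suc j) (λ l → ℤ→ℚ (s j l) * I * 1ℚ * powℚ x l)
      ≡⟨ ∑-cong (suc j) (λ l _ → regroup (ℤ→ℚ (s j l)) (powℚ x l)) ⟩
    ∑ (suc j) (λ l → I * (ℤ→ℚ (s j l) * powℚ x l))
      ≡⟨ *-distribˡ-sumFrom I 0 (suc j) (λ l → ℤ→ℚ (s j l) * powℚ x l) ⟨
    I * ∑ (suc j) (λ l → ℤ→ℚ (s j l) * powℚ x l)
      ≡⟨ cong (I *_) (∑-stirling j (suc j) x ℕ.≤-refl) ⟩
    I * falling j x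
      ≡⟨ *-comm I (falling j x) ⟩
    x choose j
      ∎
    where
    open ≡-Reasoning
    open ℚ-Solver
    x = 1ℚ - ℕ→ℚ r
    I = invFact j
    regroup : ∀ a p → a * I * 1ℚ * p ≡ I * (a * p)
    regroup a p = solve 3 (λ a I p → a :* I :* con 1ℚ :* p := I :* (a :* p)) refl a I p

  ∑-A : ∀ j r → ∑ (suc j) (A j r) ≡ (1ℚ + (1ℚ - ℕ→ℚ r)) choose j
  ∑-A j r = begin
    ∑ (suc j) (A j r)
      ≡⟨ ∑-cong (suc j) (λ t t<1+j → A-as-∑ j r t (ℕ.<⇒≤ t<1+j)) ⟩
    ∑ (suc j) (λ t → ∑ (suc j) (A-summand j r t))
      ≡⟨ sumFrom-comm 0 (suc j) 0 (suc j) (A-summand j r) ⟩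
    ∑ (suc j) (λ l → ∑ (suc j) (λ t → A-summand j r t l))
      ≡⟨ ∑-cong (suc j) column ⟩
    ∑ (suc j) (λ l → I * (ℤ→ℚ (s j l) * powℚ (1ℚ + x) l))
      ≡⟨ *-distribˡ-sumFrom I 0 (suc j) (λ l → ℤ→ℚ (s j l) * powℚ (1ℚ + x) l) ⟨
    I * ∑ (suc j) (λ l → ℤ→ℚ (s j l) * powℚ (1ℚ + x) l)
      ≡⟨ cong (I *_) (∑-stirling j (suc j) (1ℚ + x) ℕ.≤-refl) ⟩
    I * falling j (1ℚ + x)
      ≡⟨ *-comm I (falling j (1ℚ + x)) ⟩
    (1ℚ + x) choose j
      ∎
    where
    open ≡-Reasoning
    open ℚ-Solver
    x = 1ℚ - ℕ→ℚ r
    I = invFact j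
    column : ∀ l → l < suc j → ∑ (suc j) (λ t → A-summand j r t l) ≡ I * (ℤ→ℚ (s j l) * powℚ (1ℚ + x) l)
    column l l<1+j = begin
      ∑ (suc j) (λ t → a * I * ℕ→ℚ (l Comb.C t) * powℚ x (l ∸ t))
        ≡⟨ ∑-cong (suc j) (λ t _ → *-assoc (a * I) _ _) ⟩
      ∑ (suc j) (λ t → a * I * (ℕ→ℚ (l Comb.C t) * powℚ x (l ∸ t)))
        ≡⟨ *-distribˡ-sumFrom (a * I) 0 (suc j) _ ⟨
      a * I * ∑ (suc j) (λ t → ℕ→ℚ (l Comb.C t) * powℚ x (l ∸ t))
        ≡⟨ cong (a * I *_) (∑-binomial l (suc j) x l<1+j) ⟩
      a * I * powℚ (1ℚ + x) l
        ≡⟨ solve 3 (λ a I p → a :* I :* p := I :* (a :* p)) refl a I (powℚ (1ℚ + x) l) ⟩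
      I * (a * powℚ (1ℚ + x) l)
        ∎
      where a = ℤ→ℚ (s j l)

  sumFrom1-A : ∀ j r → sumFrom 1 (suc j) (A (suc j) r) ≡ (1ℚ - ℕ→ℚ r) choose j
  sumFrom1-A j r = begin
    S                                         ≡⟨ solve 2 (λ a S → S := (a :+ S) :- a) refl A₀ S ⟩
    (A₀ + S) - A₀                             ≡⟨ cong₂ _-_ (∑-A (suc j) r) (A-zero (suc j) r) ⟩
    (1ℚ + x) choose suc j - B                 ≡⟨ cong (_- B) (choose-pascal x j) ⟩
    (B + x choose j) - B                      ≡⟨ solve 2 (λ a b → (a :+ b) :- a := b) refl B (x choose j) ⟩
    x choose j                                ∎
    where
    open ≡-Reasoning
    open ℚ-Solver
    x = 1ℚ - ℕ→ℚ r
    A₀ = A (suc j) r 0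
    S = sumFrom 1 (suc j) (A (suc j) r)
    B = x choose suc j

  C-as-∑ : ∀ k r t → t ≤ k → C (suc k) r (suc t) ≡ ∑ (suc k) (λ m → ℕ→ℚ (k Comb.C m) * A (suc m) r (suc t))
  C-as-∑ k r t t≤k = begin
    ∑ (suc (k ∸ t)) (λ i → ℕ→ℚ (k Comb.C (i ℕ.+ suc t ∸ 1)) * A (i ℕ.+ suc t) r (suc t))
      ≡⟨ ∑-cong (suc (k ∸ t)) (λ i _ → cong (λ n → ℕ→ℚ (k Comb.C (n ∸ 1)) * A n r (suc t))
                                            (i+[1+t]≡1+[t+i] i)) ⟩
    ∑ (suc (k ∸ t)) (λ i → G (t ℕ.+ i))
      ≡⟨ sumFrom-shift t (suc (k ∸ t)) G ⟨
    sumFrom t (suc (k ∸ t)) G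
      ≡⟨ sumFrom-extend t (suc (k ∸ t)) G below-t ⟩
    ∑ (t ℕ.+ suc (k ∸ t)) G
      ≡⟨ cong (λ n → ∑ n G) (trans (ℕ.+-suc t (k ∸ t)) (cong suc (ℕ.m+[n∸m]≡n t≤k))) ⟩
    ∑ (suc k) G
      ∎
    where
    open ≡-Reasoning
    G : ℕ → ℚ
    G m = ℕ→ℚ (k Comb.C m) * A (suc m) r (suc t)
    i+[1+t]≡1+[t+i] : ∀ i → i ℕ.+ suc t ≡ suc (t ℕ.+ i)
    i+[1+t]≡1+[t+i] i = trans (ℕ.+-suc i t) (cong suc (ℕ.+-comm i t))
    below-t : ∀ m → m < t → G m ≡ 0ℚ
    below-t m m<t = trans (cong (ℕ→ℚ (k Comb.C m) *_) (A-vanishes r (s<s m<t))) (*-zeroʳ (ℕ→ℚ (k Comb.C m)))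

  sumFrom1-C : ∀ k r → sumFrom 1 (suc k) (C (suc k) r) ≡ (1ℚ - ℕ→ℚ r + ℕ→ℚ k) choose k
  sumFrom1-C k r = begin
    sumFrom 1 (suc k) (C (suc k) r)
      ≡⟨ sumFrom-shift 1 (suc k) (C (suc k) r) ⟩
    ∑ (suc k) (λ t → C (suc k) r (suc t))
      ≡⟨ ∑-cong (suc k) (λ t t<1+k → C-as-∑ k r t (ℕ.s≤s⁻¹ t<1+k)) ⟩
    ∑ (suc k) (λ t → ∑ (suc k) (λ m → c m * A (suc m) r (suc t)))
      ≡⟨ sumFrom-comm 0 (suc k) 0 (suc k) (λ t m → c m * A (suc m) r (suc t)) ⟩
    ∑ (suc k) (λ m → ∑ (suc k) (λ t → c m * A (suc m) r (suc t)))
      ≡⟨ ∑-cong (suc k) (λ m _ → *-distribˡ-sumFrom (c m) 0 (suc k) (λ t → A (suc m) r (suc t))) ⟨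
    ∑ (suc k) (λ m → c m * ∑ (suc k) (λ t → A (suc m) r (suc t)))
      ≡⟨ ∑-cong (suc k) (λ m m<1+k → cong (c m *_) (row m m<1+k)) ⟩
    ∑ (suc k) (λ m → c m * x choose m)
      ≡⟨ ∑-vandermonde k (suc k) 0 x ℕ.≤-refl ⟩
    (x + ℕ→ℚ k) choose k
      ∎
    where
    open ≡-Reasoning
    x = 1ℚ - ℕ→ℚ r
    c : ℕ → ℚ
    c m = ℕ→ℚ (k Comb.C m)
    row : ∀ m → m < suc k → ∑ (suc k) (λ t → A (suc m) r (suc t)) ≡ x choose m
    row m m<1+k = begin
      ∑ (suc k) (A (suc m) r ∘ suc)        ≡⟨ ∑-extend (A (suc m) r ∘ suc) m<1+k (λ _ m<t → A-vanishes r (s<s m<t)) ⟩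
      ∑ (suc m) (A (suc m) r ∘ suc)        ≡⟨ sumFrom-suc 0 (suc m) (A (suc m) r) ⟨
      sumFrom 1 (suc m) (A (suc m) r)      ≡⟨ sumFrom1-A m r ⟩
      x choose m                           ∎

  prodFrom-last : ∀ a n g → prodFrom a (suc n) g ≡ prodFrom a n g ℤ.* g (a ℕ.+ n)
  prodFrom-last a zero    g rewrite ℕ.+-identityʳ a = ℤ.*-comm (g a) (ℤ.+ 1)
  prodFrom-last a (suc n) g = begin
    g a ℤ.* prodFrom (suc a) (suc n) g                  ≡⟨ cong (g a ℤ.*_) (prodFrom-last (suc a) n g) ⟩
    g a ℤ.* (prodFrom (suc a) n g ℤ.* g (suc a ℕ.+ n))  ≡⟨ ℤ.*-assoc (g a) _ _ ⟨
    prodFrom a (suc n) g ℤ.* g (suc a ℕ.+ n)            ≡⟨ cong (λ m → prodFrom a (suc n) g ℤ.* g m) (ℕ.+-suc a n) ⟨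
    prodFrom a (suc n) g ℤ.* g (a ℕ.+ suc n)            ∎
    where open ≡-Reasoning

  signed-prodFrom : ∀ a g (F : ℕ → ℚ) → F 0 ≡ 1ℚ →
    (∀ n → F (suc n) ≡ F n * ℤ→ℚ (ℤ.- g (a ℕ.+ n))) →
    ∀ n → F n ≡ ℤ→ℚ (negOnePow n ℤ.* prodFrom a n g)
  signed-prodFrom a g F F₀ F-suc zero    = F₀
  signed-prodFrom a g F F₀ F-suc (suc n) = begin
    F (suc n)                                          ≡⟨ F-suc n ⟩
    F n * ℤ→ℚ (ℤ.- c)                                  ≡⟨ cong (_* ℤ→ℚ (ℤ.- c)) (signed-prodFrom a g F F₀ F-suc n) ⟩
    ℤ→ℚ (σ ℤ.* P) * ℤ→ℚ (ℤ.- c)                        ≡⟨ ℤ→ℚ-homo-* (σ ℤ.* P) (ℤ.- c) ⟨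
    ℤ→ℚ (σ ℤ.* P ℤ.* ℤ.- c)                            ≡⟨ cong ℤ→ℚ (solve 3 (λ σ P c → σ :* P :* (:- c) := (:- σ) :* (P :* c)) refl σ P c) ⟩
    ℤ→ℚ (ℤ.- σ ℤ.* (P ℤ.* c))                          ≡⟨ cong (λ Q → ℤ→ℚ (ℤ.- σ ℤ.* Q)) (prodFrom-last a n g) ⟨
    ℤ→ℚ (negOnePow (suc n) ℤ.* prodFrom a (suc n) g)   ∎
    where
    open ≡-Reasoning
    open ℤ-Solver
    σ = negOnePow n
    P = prodFrom a n g
    c = g (a ℕ.+ n)

  falling[1-r] : ∀ r n →
    falling n (1ℚ - ℕ→ℚ r) ≡ ℤ→ℚ (negOnePow n ℤ.* prodFrom 1 n (λ i → ℤ.+ r ℤ.+ ℤ.+ i ℤ.- ℤ.+ 2))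
  falling[1-r] r = signed-prodFrom 1 _ (λ n → falling n x) refl (λ n → cong (falling n x *_) (sym (factor n)))
    where
    x = 1ℚ - ℕ→ℚ r
    factor : ∀ n → ℤ→ℚ (ℤ.- (ℤ.+ r ℤ.+ ℤ.+ suc n ℤ.- ℤ.+ 2)) ≡ x - ℕ→ℚ n
    factor n = begin
      ℤ→ℚ (ℤ.- (ℤ.+ r ℤ.+ ℤ.+ suc n ℤ.- ℤ.+ 2))
        ≡⟨ cong ℤ→ℚ (solve 2 (λ r n → :- (r :+ (con ℤ.1ℤ :+ n) :- con (ℤ.+ 2)) := con ℤ.1ℤ :- r :- n)
                              refl (ℤ.+ r) (ℤ.+ n)) ⟩
      ℤ→ℚ (ℤ.+ 1 ℤ.- ℤ.+ r ℤ.- ℤ.+ n)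
        ≡⟨ ℤ→ℚ-homo-minus (ℤ.+ 1 ℤ.- ℤ.+ r) (ℤ.+ n) ⟩
      ℤ→ℚ (ℤ.+ 1 ℤ.- ℤ.+ r) - ℕ→ℚ n
        ≡⟨ cong (_- ℕ→ℚ n) (ℤ→ℚ-homo-minus (ℤ.+ 1) (ℤ.+ r)) ⟩
      x - ℕ→ℚ n
        ∎
      where
      open ≡-Reasoning
      open ℤ-Solver

  falling[1-r+n] : ∀ r n →
    falling n (1ℚ - ℕ→ℚ r + ℕ→ℚ n) ≡ ℤ→ℚ (negOnePow n ℤ.* prodFrom 2 n (λ i → ℤ.+ r ℤ.- ℤ.+ i))
  falling[1-r+n] r = signed-prodFrom 2 _ (λ n → falling n (x + ℕ→ℚ n)) refl step
    where
    x = 1ℚ - ℕ→ℚ r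
    factor : ∀ n → ℤ→ℚ (ℤ.- (ℤ.+ r ℤ.- ℤ.+ (2 ℕ.+ n))) ≡ 1ℚ + (x + ℕ→ℚ n)
    factor n = begin
      ℤ→ℚ (ℤ.- (ℤ.+ r ℤ.- ℤ.+ (2 ℕ.+ n)))
        ≡⟨ cong ℤ→ℚ (solve 2 (λ r n → :- (r :- (con ℤ.1ℤ :+ (con ℤ.1ℤ :+ n))) := con ℤ.1ℤ :+ (con ℤ.1ℤ :- r :+ n))
                              refl (ℤ.+ r) (ℤ.+ n)) ⟩
      ℤ→ℚ (ℤ.+ 1 ℤ.+ (ℤ.+ 1 ℤ.- ℤ.+ r ℤ.+ ℤ.+ n))
        ≡⟨ ℤ→ℚ-homo-+ (ℤ.+ 1) (ℤ.+ 1 ℤ.- ℤ.+ r ℤ.+ ℤ.+ n) ⟩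
      1ℚ + ℤ→ℚ (ℤ.+ 1 ℤ.- ℤ.+ r ℤ.+ ℤ.+ n)
        ≡⟨ cong (1ℚ +_) (ℤ→ℚ-homo-+ (ℤ.+ 1 ℤ.- ℤ.+ r) (ℤ.+ n)) ⟩
      1ℚ + (ℤ→ℚ (ℤ.+ 1 ℤ.- ℤ.+ r) + ℕ→ℚ n)
        ≡⟨ cong (λ u → 1ℚ + (u + ℕ→ℚ n)) (ℤ→ℚ-homo-minus (ℤ.+ 1) (ℤ.+ r)) ⟩
      1ℚ + (x + ℕ→ℚ n)
        ∎
      where
      open ≡-Reasoning
      open ℤ-Solver
    step : ∀ n → falling (suc n) (x + ℕ→ℚ (suc n))
                 ≡ falling n (x + ℕ→ℚ n) * ℤ→ℚ (ℤ.- (ℤ.+ r ℤ.- ℤ.+ (2 ℕ.+ n)))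
    step n = begin
      falling (suc n) (x + ℕ→ℚ (suc n))
        ≡⟨ cong (λ u → falling (suc n) (x + u)) (ℕ→ℚ-suc n) ⟩
      falling (suc n) (x + (1ℚ + ℕ→ℚ n))
        ≡⟨ cong (falling (suc n)) (+-solve x (ℕ→ℚ n)) ⟩
      falling (suc n) (1ℚ + (x + ℕ→ℚ n))
        ≡⟨ falling-suc-shift n (x + ℕ→ℚ n) ⟩
      (1ℚ + (x + ℕ→ℚ n)) * falling n (x + ℕ→ℚ n)
        ≡⟨ *-comm (1ℚ + (x + ℕ→ℚ n)) (falling n (x + ℕ→ℚ n)) ⟩
      falling n (x + ℕ→ℚ n) * (1ℚ + (x + ℕ→ℚ n))
        ≡⟨ cong (falling n (x + ℕ→ℚ n) *_) (factor n) ⟨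
      falling n (x + ℕ→ℚ n) * ℤ→ℚ (ℤ.- (ℤ.+ r ℤ.- ℤ.+ (2 ℕ.+ n)))
        ∎
      where
      open ≡-Reasoning
      open ℚ-Solver
      +-solve : ∀ x n → x + (1ℚ + n) ≡ 1ℚ + (x + n)
      +-solve = solve 2 (λ x n → x :+ (con 1ℚ :+ n) := con 1ℚ :+ (x :+ n)) refl

open import Data.Nat using (suc; z≤n; s≤s)
open import Data.Integer using (+_; _+_; _-_; _*_)
import Data.Rational
open import Data.Product using (_×_; _,_)
open import Relation.Binary.PropositionalEquality using (_≡_; trans; cong)

-- Both identities are polynomial in r.
theorem2p8 : ∀ (r j k : ℕ) → 1 ≤ r → 1 ≤ j → 1 ≤ k →
    (Σ[ 1 ⋯ j ] (λ t → A j r t)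
    ≡ ℤ→ℚ (negOnePow (j ∸ 1) * Π[ 1 ⋯ j ∸ 1 ] (λ i → (+ r) + (+ i) - (+ 2))) Data.Rational.* invFact (j ∸ 1))
    × (Σ[ 1 ⋯ k ] (λ t → C k r t)
    ≡ ℤ→ℚ (negOnePow (k ∸ 1) * Π[ 2 ⋯ k ] (λ i → (+ r) - (+ i))) Data.Rational.* invFact (k ∸ 1))
theorem2p8 r (suc j) (suc k) _ (s≤s z≤n) (s≤s z≤n) =
    trans (sumFrom1-A j r) (cong (Data.Rational._* invFact j) (falling[1-r] r j))
  , trans (sumFrom1-C k r) (cong (Data.Rational._* invFact k) (falling[1-r+n] r k))
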